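{- For $i\in\{0,\dots,n\}$, the map $$(\pi_0,\dots,\pi_{s-1},0_{c_{b_i}})\mapsto\bigl((\eta(\pi_0),\dots,\eta(\pi_{s-1}),\eta(\omega_i)),(\zeta(\pi_0),\dots,\zeta(\pi_{s-1}),\zeta(\omega_i))\bigr)$$ is a bijection from $\mathcal P_{i,\rho}$ to $\mathcal F^{0_{c_{\overline{i+1}}},0_{c_i}}_>$ if $i\in\{1,\dots,n\}$, and to $\mathcal F^{0_{c_{\overline1}},(-1)_{c_{\overline1}}}_>$ if $i=0$; it preserves the size and the colour sequence of all parts except the last.
   Context: $\overline{[n]}=\{1<\dots<n<\overline n<\dots<\overline1\}$, $\overline{\overline k}=k$, and $\overline{n+1}:=n$. $\chi$ = truth value in $\{0,1\}$. Primary-coloured integers $k_{c_u}$ ($u\in\overline{[n]}$) with $k_{c_u}\ge l_{c_v}$ iff $k-l\ge\chi(u<v)$ and $k_{c_u}>l_{c_v}$ iff $k-l\ge\chi(u\le v)$; $k_c+1=(k+1)_c$. Secondary colours $c_{x,y}=c_xc_y$ ($x\le y$), with $\eta(2k_{c_{x,y}})=k_{c_y}$, $\zeta(2k_{c_{x,y}})=k_{c_x}$, $\eta((2k+1)_{c_{x,y}})=(k+1)_{c_x}$, $\zeta((2k+1)_{c_{x,y}})=k_{c_y}$. $\omega_0=(-1)_{c_{\overline1,\overline1}}$, $\omega_i=0_{c_{i,\overline{i+1}}}$ for $i\ge1$. Energy $H$ on $\mathcal B=\{\emptyset\}\sqcup\{(x,y):x\le y\in\overline{[n]}\}$: $H(\emptyset\otimes\emptyset)=0$,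 $H(\emptyset\otimes(x,y))=H((x,y)\otimes\emptyset)=1$, $H((x,y)\otimes(x',y'))=\chi(x\ge x')+\chi(y\ge y')-\chi(y\ge y'>x\ge x')$ if $\overline{y'}\ne x$, $=\chi(x>x')+\chi(y>y')-\chi(y>y'>x>x')$ if $\overline{y'}=x$. Colours $c_b$ ($b\in\mathcal B$), $c_{(x,y)}=c_{x,y}$; $b_0=\emptyset$, $b_k=(k,\overline k)$. $\mathcal S=\{c_{x,y}\}$, $c_\infty$ new; $\rho_i(c_{b_i},c_\infty)=1$, $\rho_i(c_b,c_\infty)=H(b_i\otimes b)$ for $c_b\in\mathcal S\setminus\{c_{b_i}\}$, $\rho_i(c_{x',y'},c_{x,y})=\chi(x\ge x')+\chi(y\ge y')-\chi(y\ge y'>x\ge x')$. $\mathcal P_{i,\rho}$ is the set of sequences $(\pi_0,\dots,\pi_{s-1},0_{c_{b_i}})$ of coloured integers with $c(\pi_j)\in\mathcal S$ ($j<s$) such that, reading the last part as $0_{c_\infty}$, $|\pi_j|-|\pi_{j+1}|\ge\rho_i(c(\pi_j),c(\pi_{j+1}))$ for $j<s$. For primary-coloured $k_c,l_d$ with $l_d\le k_c\le(l+1)_d$, $\mathcal F^{k_c,l_d}_>$ is the set of pairs $(\mu,\nu)$, $\mu=(\mu_0,\dots,\mu_{s-1},k_c)$, $\nu=(\nu_0,\dots,\nu_{s-1},l_d)$, strictly decreasing for $>$, with $\nu_j+1\ge\mu_j\ge\nu_j$ for $j<s$; size $\sum_{j<s}(|\mu_j|+|\nu_j|)$ and colour sequence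 $\prod_{j<s}c(\mu_j)c(\nu_j)$. -}

module Defs where

open import Data.Nat as ℕ using (ℕ; zero; suc)
open import Data.Integer as ℤ using (ℤ; +_; -[1+_]; _-_; _≥_; _/ℕ_; _%ℕ_)
open import Data.Fin as Fin using (Fin; zero; suc; toℕ; opposite; fromℕ<)
open import Data.Fin.Properties using (_≟_; _≤?_; _<?_)
open import Data.List using (List; []; _∷_; _∷ʳ_; map; foldr; zipWith)
open import Data.List.Relation.Binary.Pointwise using (Pointwise)
open import Data.Product using (Σ; _×_; _,_)
open import Data.Unit using (⊤)
open import Relation.Nullary using (Dec; yes; no)
open import Relation.Nullary.Decidable using (_×-dec_)
open import Relation.Binary.PropositionalEquality using (_≡_)

-- Colours.  [n]bar = {1 < ... < n < nbar < ... < 1bar} is encoded as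
-- Fin (n + n), ordered by index:  colour k (1 ≤ k ≤ n) is index k-1,
-- colour kbar is index 2n-k.  Bar is Fin.opposite.

Col : ℕ → Set
Col n = Fin (n ℕ.+ n)

unbarred : (n : ℕ) → Fin n → Col n
unbarred n j = j Fin.↑ˡ n

barred : (n : ℕ) → Fin n → Col n
barred n j = opposite (unbarred n j)

-- colour overline{k+1} (k = j + 1), with the convention overline{n+1} = n
barNext : (n : ℕ) → Fin n → Col n
barNext n j with suc (toℕ j) ℕ.<? n
... | yes p = barred n (fromℕ< p)
... | no _  = unbarred n j

χ : {P : Set} → Dec P → ℤ
χ (yes _) = + 1
χ (no _)  = + 0

record PInt (n : ℕ) : Set where
  constructor _⟨_⟩
  field
    val : ℤ
    col : Col n
open PInt public

_≥ₚ_ : {n : ℕ} → PInt n → PInt n → Set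
(k ⟨ u ⟩) ≥ₚ (l ⟨ v ⟩) = k - l ≥ χ (u <? v)

_>ₚ_ : {n : ℕ} → PInt n → PInt n → Set
(k ⟨ u ⟩) >ₚ (l ⟨ v ⟩) = k - l ≥ χ (u ≤? v)

suc₁ : {n : ℕ} → PInt n → PInt n
suc₁ (k ⟨ u ⟩) = (k ℤ.+ + 1) ⟨ u ⟩

-- Secondary-coloured integers k_{c_{x,y}}  (x ≤ y required where used)

record SInt (n : ℕ) : Set where
  constructor _⟪_,_⟫
  field
    sval : ℤ
    cx   : Col n
    cy   : Col n
open SInt public

η : {n : ℕ} → SInt n → PInt n
η (m ⟪ x , y ⟫) with m %ℕ 2
... | zero  = (m /ℕ 2) ⟨ y ⟩
... | suc _ = ((m /ℕ 2) ℤ.+ + 1) ⟨ x ⟩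

ζ : {n : ℕ} → SInt n → PInt n
ζ (m ⟪ x , y ⟫) with m %ℕ 2
... | zero  = (m /ℕ 2) ⟨ x ⟩
... | suc _ = (m /ℕ 2) ⟨ y ⟩

-- From here on n = suc m (so that the colour 1bar exists); i ∈ {0,…,n}
-- is an element of Fin (suc n): zero is i = 0, suc j is i = j + 1.

ω : (m : ℕ) → Fin (suc (suc m)) → SInt (suc m)
ω m zero    = (-[1+ 0 ]) ⟪ barred (suc m) zero , barred (suc m) zero ⟫
ω m (suc j) = (+ 0) ⟪ unbarred (suc m) j , barNext (suc m) j ⟫

data B (n : ℕ) : Set where
  ∅    : B n
  pair : Col n → Col n → B n

H : {n : ℕ} → B n → B n → ℤ
H ∅ ∅ = + 0
H ∅ (pair _ _) = + 1
H (pair _ _) ∅ = + 1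
H {n} (pair x y) (pair x' y') with opposite y' ≟ x
... | no _  = (χ (x' ≤? x) ℤ.+ χ (y' ≤? y))
              - χ ((y' ≤? y) ×-dec ((x <? y') ×-dec (x' ≤? x)))
... | yes _ = (χ (x' <? x) ℤ.+ χ (y' <? y))
              - χ ((y' <? y) ×-dec ((x <? y') ×-dec (x' <? x)))

bi : (m : ℕ) → Fin (suc (suc m)) → B (suc m)
bi m zero    = ∅
bi m (suc j) = pair (unbarred (suc m) j) (barred (suc m) j)

ρ∞ : (m : ℕ) → Fin (suc (suc m)) → Col (suc m) → Col (suc m) → ℤ
ρ∞ m zero x y = H (bi m zero) (pair x y)       -- c_{b_0} = c_∅ ∉ S
ρ∞ m (suc j) x y with x ≟ unbarred (suc m) j | y ≟ barred (suc m) j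
... | yes _ | yes _ = + 1
... | _     | _     = H (bi m (suc j)) (pair x y)

ρS : {n : ℕ} → (x' y' x y : Col n) → ℤ
ρS x' y' x y = (χ (x' ≤? x) ℤ.+ χ (y' ≤? y))
               - χ ((y' ≤? y) ×-dec ((x <? y') ×-dec (x' ≤? x)))

-- P_{i,ρ}.  An element (π_0,…,π_{s-1},0_{c_{b_i}}) is represented by the
-- list (π_0,…,π_{s-1}) of its non-final parts (the final part is fixed).

ValidS : {n : ℕ} → SInt n → Set
ValidS p = cx p Fin.≤ cy p

-- difference conditions, the last part read as 0_{c_∞}
ChainP : (m : ℕ) → Fin (suc (suc m)) → List (SInt (suc m)) → Set
ChainP m i [] = ⊤
ChainP m i (p ∷ []) = sval p - + 0 ≥ ρ∞ m i (cx p) (cy p)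
ChainP m i (p ∷ q ∷ ps) =
  (sval p - sval q ≥ ρS {suc m} (cx p) (cy p) (cx q) (cy q)) × ChainP m i (q ∷ ps)

data AllL {A : Set} (P : A → Set) : List A → Set where
  []  : AllL P []
  _∷_ : {a : A} {as : List A} → P a → AllL P as → AllL P (a ∷ as)

InP : (m : ℕ) → Fin (suc (suc m)) → List (SInt (suc m)) → Set
InP m i ps = AllL ValidS ps × ChainP m i ps

Decr : {n : ℕ} → List (PInt n) → Set
Decr [] = ⊤
Decr (a ∷ []) = ⊤
Decr (a ∷ b ∷ as) = (a >ₚ b) × Decr (b ∷ as)

Interl : {n : ℕ} → PInt n → PInt n → Set
Interl μj νj = (suc₁ νj ≥ₚ μj) × (μj ≥ₚ νj)

InF : {n : ℕ} → PInt n → PInt n → List (PInt n) → List (PInt n) → Set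
InF k l μ ν =
  Σ (List _) λ μ' → Σ (List _) λ ν' →
    (μ ≡ μ' ∷ʳ k) × (ν ≡ ν' ∷ʳ l) × Pointwise Interl μ' ν' × Decr μ × Decr ν

tgtK : (m : ℕ) → Fin (suc (suc m)) → PInt (suc m)
tgtK m zero    = (+ 0) ⟨ barred (suc m) zero ⟩
tgtK m (suc j) = (+ 0) ⟨ barNext (suc m) j ⟩

tgtL : (m : ℕ) → Fin (suc (suc m)) → PInt (suc m)
tgtL m zero    = (-[1+ 0 ]) ⟨ barred (suc m) zero ⟩
tgtL m (suc j) = (+ 0) ⟨ unbarred (suc m) j ⟩

Φμ : (m : ℕ) → Fin (suc (suc m)) → List (SInt (suc m)) → List (PInt (suc m))
Φμ m i ps = map η ps ∷ʳ η (ω m i)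

Φν : (m : ℕ) → Fin (suc (suc m)) → List (SInt (suc m)) → List (PInt (suc m))
Φν m i ps = map ζ ps ∷ʳ ζ (ω m i)

sumℤ : List ℤ → ℤ
sumℤ = foldr ℤ._+_ (+ 0)

dropLast : {A : Set} → List A → List A
dropLast [] = []
dropLast (a ∷ []) = []
dropLast (a ∷ b ∷ as) = a ∷ dropLast (b ∷ as)

sizeP : {n : ℕ} → List (SInt n) → ℤ
sizeP ps = sumℤ (map sval ps)

sizeF : {n : ℕ} → List (PInt n) → List (PInt n) → ℤ
sizeF μ ν = sumℤ (map val (dropLast μ)) ℤ.+ sumℤ (map val (dropLast ν))

SCol : ℕ → Set
SCol n = Col n × Col n

prodCol : {n : ℕ} → Col n → Col n → SCol n
prodCol u v with u ≤? v
... | yes _ = u , v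
... | no _  = v , u

colsP : {n : ℕ} → List (SInt n) → List (SCol n)
colsP {n} ps = map (λ (p : SInt n) → cx p , cy p) ps

colsF : {n : ℕ} → List (PInt n) → List (PInt n) → List (SCol n)
colsF {n} μ ν = zipWith (prodCol {n}) (map col (dropLast μ)) (map col (dropLast ν))

module Submission where

-- Write a part as π = (2k + e)_{c_{x,y}} with e ∈ {0,1} and x ≤ y: η(π) is k + e coloured by x if e = 1
-- and by y if e = 0, and ζ(π) is k coloured by the other colour.  So (η, ζ) is a bijection from such parts
-- onto the interlaced pairs ν + 1 ≥ μ ≥ ν, preserving size (|π| = |η(π)| + |ζ(π)|) and colour (c_{x,y} = c_x c_y).
-- The heart of the matter is local: for two parts π, π' the condition |π| − |π'| ≥ ρ(c(π), c(π')) holds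
-- exactly when η(π) > η(π') and ζ(π) > ζ(π').  Both sides depend only on k − k', the two parities and the
-- four comparisons between {x', y'} and {x, y}, so this is a finite check.  The final part 0_{c_{b_i}} is
-- absorbed by ω_i: the condition ρ_i(c(π), c_∞) on |π| − 0 is the condition ρ(c(π), c(ω_i)) on |π| − |ω_i|.
-- For i ≥ 1 this compares the energy H(b_i ⊗ (x,y)) with ρ(c_{x,y}, c_{i,\overline{i+1}}), using that
-- \overline{i} is the successor of \overline{i+1}; for i = 0 both conditions say |π| ≥ 1.

open import Defs
open import Data.Bool using (Bool; true; false; not; _∧_; T; if_then_else_)
open import Data.Bool.Properties using (T?; T-∧)
open import Data.Empty using (⊥-elim)
open import Data.Fin as Fin using (Fin; toℕ; zero; suc; opposite; _↑ˡ_; fromℕ<)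
open import Data.Fin.Properties
  using ( _≤?_; _<?_; _≟_; toℕ-↑ˡ; toℕ-fromℕ<; toℕ<n; toℕ≤pred[n]
        ; opposite-prop; opposite-involutive; ≤∧≢⇒<)
  renaming (≤-antisym to ≤ᶠ-antisym)
open import Data.Integer.Base as ℤ using (ℤ; +_; -[1+_]; _+_; _-_; _*_; _/ℕ_; _%ℕ_; +≤+)
open import Data.Integer.DivMod using (a≡a%ℕn+[a/ℕn]*n; n%ℕd<d)
open import Data.Integer.Properties using (+-identityʳ; +-inverseʳ; *-cancelʳ-≡)
  renaming (≤-refl to ≤ℤ-refl; ≤-reflexive to ≤ℤ-reflexive; _≤?_ to _≤ℤ?_)
open import Data.Integer.Tactic.RingSolver using (solve-∀)
open import Data.List using (List; []; _∷_; _∷ʳ_; map; zipWith)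
open import Data.List.Properties using (∷-injective; ∷ʳ-injectiveˡ)
open import Data.List.Relation.Binary.Pointwise using (Pointwise; []; _∷_)
open import Data.Nat as ℕ using (ℕ; zero; suc; s≤s; z≤n; _∸_)
import Data.Nat.Properties as ℕₚ
open import Data.Product using (Σ; _×_; _,_; proj₁)
open import Data.Product.Function.NonDependent.Propositional using (_×-⇔_)
open import Data.Sum using (_⊎_; inj₁; inj₂)
open import Data.Unit using (tt)
open import Function using (_∘_)
open import Function.Bundles using (_⇔_; mk⇔; Equivalence)
import Function.Properties.Equivalence as ⇔
open import Relation.Nullary using (Dec; yes; no; does; ¬_)
open import Relation.Nullary.Decidable using (_×-dec_; _→-dec_; map′; from-yes)
open import Relation.Binary.PropositionalEquality

bit : Bool → ℤ
bit false = + 0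
bit true  = + 1

module _ {P : Set} where

  χ-bit : (p : Dec P) → χ p ≡ bit (does p)
  χ-bit (yes _) = refl
  χ-bit (no _)  = refl

  χ-yes : P → (p : Dec P) → χ p ≡ + 1
  χ-yes _ (yes _)  = refl
  χ-yes x (no ¬x)  = ⊥-elim (¬x x)

  χ-no : ¬ P → (p : Dec P) → χ p ≡ + 0
  χ-no ¬x (yes x) = ⊥-elim (¬x x)
  χ-no _  (no _)  = refl

  χ≤1 : (p : Dec P) → χ p ℤ.≤ + 1
  χ≤1 (yes _) = ≤ℤ-refl
  χ≤1 (no _)  = +≤+ z≤n

  χ≤0⇒¬ : (p : Dec P) → χ p ℤ.≤ + 0 → ¬ P
  χ≤0⇒¬ (yes _)  (+≤+ ())
  χ≤0⇒¬ (no ¬x) _ = ¬x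

  χ≰-[1+_] : (p : Dec P) (k : ℕ) → ¬ (χ p ℤ.≤ -[1+ k ])
  χ≰-[1+_] (yes _) _ ()
  χ≰-[1+_] (no _)  _ ()

χ-cong : {P Q : Set} → P ⇔ Q → (p : Dec P) (q : Dec Q) → χ p ≡ χ q
χ-cong P⇔Q (yes x) q = sym (χ-yes (Equivalence.to P⇔Q x) q)
χ-cong P⇔Q (no ¬x) q = sym (χ-no (¬x ∘ Equivalence.from P⇔Q) q)

does-complement : {P Q : Set} → (P → ¬ Q) → (¬ Q → P) →
                  (p : Dec P) (q : Dec Q) → does p ≡ not (does q)
does-complement P⇒¬Q _    (yes p) (yes q) = ⊥-elim (P⇒¬Q p q)
does-complement _    _    (yes _) (no _)  = refl
does-complement _    _    (no _)  (yes _) = refl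
does-complement _    ¬Q⇒P (no ¬p) (no ¬q) = ⊥-elim (¬p (¬Q⇒P ¬q))

_⇔-dec_ : {A B : Set} → Dec A → Dec B → Dec (A ⇔ B)
a? ⇔-dec b? = map′ (λ (f , g) → mk⇔ f g) (λ e → Equivalence.to e , Equivalence.from e)
                   ((a? →-dec b?) ×-dec (b? →-dec a?))

∀-Bool? : {P : Bool → Set} → ((b : Bool) → Dec (P b)) → Dec ((b : Bool) → P b)
∀-Bool? P? = map′ (λ (f , t) → λ { false → f ; true → t }) (λ h → h false , h true)
                  (P? false ×-dec P? true)

if-injective : {A : Set} (e : Bool) {a b c d : A} →
               (if e then a else b) ≡ (if e then c else d) →
               (if not e then a else b) ≡ (if not e then c else d) → a ≡ c × b ≡ d
if-injective false b≡d a≡c = a≡c , b≡d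
if-injective true  a≡c b≡d = a≡c , b≡d

zip-⇔ : {A B B' C D D' : Set} → A ⇔ (B × B') → C ⇔ (D × D') → (A × C) ⇔ ((B × D) × (B' × D'))
zip-⇔ A⇔ C⇔ = mk⇔
  (λ (a , c) → let (b , b') = Equivalence.to A⇔ a; (d , d') = Equivalence.to C⇔ c in (b , d) , (b' , d'))
  (λ ((b , d) , (b' , d')) → Equivalence.from A⇔ (b , b') , Equivalence.from C⇔ (d , d'))

-- Halving integers

half-decomposition : (A : ℤ) → Σ Bool λ e → Σ ℤ λ k → A ≡ bit e + k * + 2
half-decomposition A with A %ℕ 2 | a≡a%ℕn+[a/ℕn]*n A 2 | n%ℕd<d A 2
... | 0           | A≡ | _ = false , A /ℕ 2 , A≡
... | 1           | A≡ | _ = true  , A /ℕ 2 , A≡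
... | suc (suc _) | _  | s≤s (s≤s ())

double≡bit-difference : (D : ℤ) (e f : Bool) → D * + 2 ≡ bit f - bit e → D ≡ + 0 × e ≡ f
double≡bit-difference D         false false D*2≡0 = *-cancelʳ-≡ D (+ 0) (+ 2) D*2≡0 , refl
double≡bit-difference D         true  true  D*2≡0 = *-cancelʳ-≡ D (+ 0) (+ 2) D*2≡0 , refl
double≡bit-difference (+ 0)     false true  ()
double≡bit-difference (+ suc _) false true  ()
double≡bit-difference -[1+ _ ]  false true  ()
double≡bit-difference (+ 0)     true  false ()
double≡bit-difference (+ suc _) true  false ()
double≡bit-difference -[1+ _ ]  true  false ()

half-unique : ∀ e f k l → bit e + k * + 2 ≡ bit f + l * + 2 → e ≡ f × k ≡ l
half-unique e f k l eq =
  let k-l≡0 , e≡f = double≡bit-difference (k - l) e f difference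
  in  e≡f , trans (k≡l+[k-l] k l) (trans (cong (λ d → l + d) k-l≡0) (+-identityʳ l))
  where
  open ≡-Reasoning
  regroup : ∀ b k l → (k - l) * + 2 ≡ (b + k * + 2) - (b + l * + 2)
  regroup = solve-∀
  cancel : ∀ b c l → (b + l * + 2) - (c + l * + 2) ≡ b - c
  cancel = solve-∀
  k≡l+[k-l] : ∀ k l → k ≡ l + (k - l)
  k≡l+[k-l] = solve-∀
  difference : (k - l) * + 2 ≡ bit f - bit e
  difference = begin
    (k - l) * + 2                         ≡⟨ regroup (bit e) k l ⟩
    (bit e + k * + 2) - (bit e + l * + 2) ≡⟨ cong (_- (bit e + l * + 2)) eq ⟩
    (bit f + l * + 2) - (bit e + l * + 2) ≡⟨ cancel (bit f) (bit e) l ⟩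
    bit f - bit e                         ∎

-- One part: η and ζ

module _ {n : ℕ} where

  prodCol-≤ : {u v : Col n} → u Fin.≤ v → prodCol {n} u v ≡ (u , v)
  prodCol-≤ {u} {v} u≤v with u ≤? v
  ... | yes _  = refl
  ... | no u≰v = ⊥-elim (u≰v u≤v)

  prodCol-≥ : {u v : Col n} → v Fin.≤ u → prodCol {n} u v ≡ (v , u)
  prodCol-≥ {u} {v} v≤u with u ≤? v
  ... | yes u≤v = let u≡v = ≤ᶠ-antisym u≤v v≤u in cong₂ _,_ u≡v (sym u≡v)
  ... | no _    = refl

  η-ζ-half : (e : Bool) (k : ℤ) (x y : Col n) →
             η {n} ((bit e + k * + 2) ⟪ x , y ⟫) ≡ (k + bit e) ⟨ if e then x else y ⟩
           × ζ {n} ((bit e + k * + 2) ⟪ x , y ⟫) ≡ k ⟨ if not e then x else y ⟩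
  η-ζ-half e k x y
    with (bit e + k * + 2) %ℕ 2 | a≡a%ℕn+[a/ℕn]*n (bit e + k * + 2) 2 | n%ℕd<d (bit e + k * + 2) 2
  ... | 0 | A≡ | _ with half-unique e false k ((bit e + k * + 2) /ℕ 2) A≡
  ...   | refl , k≡ = cong {B = PInt n} (_⟨ y ⟩) (trans (sym k≡) (sym (+-identityʳ k)))
                    , cong {B = PInt n} (_⟨ x ⟩) (sym k≡)
  η-ζ-half e k x y | 1 | A≡ | _ with half-unique e true k ((bit e + k * + 2) /ℕ 2) A≡
  ...   | refl , k≡ = cong {B = PInt n} (λ h → (h + + 1) ⟨ x ⟩) (sym k≡)
                    , cong {B = PInt n} (_⟨ y ⟩) (sym k≡)
  η-ζ-half e k x y | suc (suc _) | _ | s≤s (s≤s ())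

  interlaced⇔ : (A B : ℤ) (u v : Col n) →
                Interl {n} (A ⟨ u ⟩) (B ⟨ v ⟩) ⇔ ((A ≡ B × v Fin.≤ u) ⊎ (A ≡ B + + 1 × u Fin.≤ v))
  interlaced⇔ A B u v =
    mk⇔ (λ (h₁ , h₂) → by-difference (A - B) refl (subst (χ (v <? u) ℤ.≤_) (swap A B) h₁) h₂) from
    where
    swap : ∀ a b → (b + + 1) - a ≡ + 1 - (a - b)
    swap = solve-∀
    [a+1]-a≡1 : ∀ a → (a + + 1) - a ≡ + 1
    [a+1]-a≡1 = solve-∀
    a≡b+[a-b] : ∀ a b → a ≡ b + (a - b)
    a≡b+[a-b] = solve-∀
    A≡B+D : ∀ {D} → A - B ≡ D → A ≡ B + D
    A≡B+D refl = a≡b+[a-b] A B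

    by-difference : ∀ D → A - B ≡ D → χ (v <? u) ℤ.≤ + 1 - D → χ (u <? v) ℤ.≤ D →
                    (A ≡ B × v Fin.≤ u) ⊎ (A ≡ B + + 1 × u Fin.≤ v)
    by-difference (+ 0) A-B≡0 _ h₂ =
      inj₁ (trans (A≡B+D A-B≡0) (+-identityʳ B) , ℕₚ.≮⇒≥ (χ≤0⇒¬ (u <? v) h₂))
    by-difference (+ 1) A-B≡1 h₁ _ =
      inj₂ (A≡B+D A-B≡1 , ℕₚ.≮⇒≥ (χ≤0⇒¬ (v <? u) h₁))
    by-difference (+ suc (suc k)) _     h₁ _  = ⊥-elim (χ≰-[1+_] (v <? u) k h₁)
    by-difference -[1+ k ]        _     _  h₂ = ⊥-elim (χ≰-[1+_] (u <? v) k h₂)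

    from : (A ≡ B × v Fin.≤ u) ⊎ (A ≡ B + + 1 × u Fin.≤ v) → Interl {n} (A ⟨ u ⟩) (B ⟨ v ⟩)
    from (inj₁ (refl , v≤u)) =
      subst (χ (v <? u) ℤ.≤_) (sym ([a+1]-a≡1 A)) (χ≤1 (v <? u)) ,
      ≤ℤ-reflexive (trans (χ-no (ℕₚ.≤⇒≯ v≤u) (u <? v)) (sym (+-inverseʳ A)))
    from (inj₂ (refl , u≤v)) =
      ≤ℤ-reflexive (trans (χ-no (ℕₚ.≤⇒≯ u≤v) (v <? u)) (sym (+-inverseʳ (B + + 1)))) ,
      subst (χ (u <? v) ℤ.≤_) (sym ([a+1]-a≡1 B)) (χ≤1 (u <? v))

  η-ζ-size : (s : SInt n) → val (η s) + val (ζ s) ≡ sval s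
  η-ζ-size (A ⟪ x , y ⟫) with half-decomposition A
  ... | e , k , refl =
    let ηs≡ , ζs≡ = η-ζ-half e k x y
    in  trans (cong₂ (λ a b → val a + val b) ηs≡ ζs≡) (regroup (bit e) k)
    where
    regroup : ∀ b k → (k + b) + k ≡ b + k * + 2
    regroup = solve-∀

  η-ζ-colour : (s : SInt n) → ValidS s → prodCol {n} (col (η s)) (col (ζ s)) ≡ (cx s , cy s)
  η-ζ-colour (A ⟪ x , y ⟫) x≤y with half-decomposition A
  ... | e , k , refl =
    let ηs≡ , ζs≡ = η-ζ-half e k x y
    in  trans (cong₂ (λ a b → prodCol {n} (col a) (col b)) ηs≡ ζs≡) (by-parity e)
    where
    by-parity : ∀ e → prodCol {n} (if e then x else y) (if not e then x else y) ≡ (x , y)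
    by-parity false = prodCol-≥ x≤y
    by-parity true  = prodCol-≤ x≤y

  η-ζ-interlaced : (s : SInt n) → ValidS s → Interl (η s) (ζ s)
  η-ζ-interlaced (A ⟪ x , y ⟫) x≤y with half-decomposition A
  ... | e , k , refl =
    let ηs≡ , ζs≡ = η-ζ-half e k x y
    in  subst₂ Interl (sym ηs≡) (sym ζs≡) (Equivalence.from (interlaced⇔ (k + bit e) k _ _) (by-parity e))
    where
    by-parity : ∀ e → (k + bit e ≡ k × (if not e then x else y) Fin.≤ (if e then x else y))
                    ⊎ (k + bit e ≡ k + + 1 × (if e then x else y) Fin.≤ (if not e then x else y))
    by-parity false = inj₁ (+-identityʳ k , x≤y)
    by-parity true  = inj₂ (refl , x≤y)

  η-ζ-surjective : (a b : PInt n) → Interl a b → Σ (SInt n) λ s → ValidS s × η s ≡ a × ζ s ≡ b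
  η-ζ-surjective (A ⟨ u ⟩) (B ⟨ v ⟩) h with Equivalence.to (interlaced⇔ A B u v) h
  ... | inj₁ (refl , v≤u) =
    let ηs≡ , ζs≡ = η-ζ-half false B v u
    in  (bit false + B * + 2) ⟪ v , u ⟫ , v≤u , trans ηs≡ (cong (_⟨ u ⟩) (+-identityʳ B)) , ζs≡
  ... | inj₂ (refl , u≤v) = (bit true + B * + 2) ⟪ u , v ⟫ , u≤v , η-ζ-half true B u v

  η-ζ-injective : (p q : SInt n) → η p ≡ η q → ζ p ≡ ζ q → p ≡ q
  η-ζ-injective p@(A ⟪ x , y ⟫) q@(A' ⟪ x' , y' ⟫) ηp≡ηq ζp≡ζq with sval≡ | half-decomposition A
    where
    sval≡ : A ≡ A'
    sval≡ = trans (sym (η-ζ-size p)) (trans (cong₂ (λ a b → val a + val b) ηp≡ηq ζp≡ζq) (η-ζ-size q))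
  ... | refl | e , k , refl
    with η-ζ-half e k x y | η-ζ-half e k x' y'
  ... | ηp≡ , ζp≡ | ηq≡ , ζq≡
    with if-injective e (cong col (trans (sym ηp≡) (trans ηp≡ηq ηq≡)))
                        (cong col (trans (sym ζp≡) (trans ζp≡ζq ζq≡)))
  ... | refl , refl = refl

-- Two consecutive parts

select : (v₁₁ v₁₀ v₀₁ v₀₀ s t : Bool) → Bool
select v₁₁ v₁₀ v₀₁ v₀₀ s t = if s then (if t then v₁₁ else v₁₀) else (if t then v₀₁ else v₀₀)

select-table : (g : Bool → Bool → Bool) (s t : Bool) →
               g s t ≡ select (g true true) (g true false) (g false true) (g false false) s t
select-table g true  true  = refl
select-table g true  false = refl
select-table g false true  = refl
select-table g false false = refl

ρᵇ : Bool → Bool → Bool → ℤ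
ρᵇ a b c = (bit a + bit b) - bit (b ∧ (c ∧ a))

-- v_st is the truth value of (x' if s else y') ≤ (x if t else y); when x' ≤ y' and x ≤ y, the entry v₀₁
-- (that is y' ≤ x) forces the other three.
PairTable : ℤ → Set
PairTable D = (e f v₁₁ v₁₀ v₀₁ v₀₀ : Bool) → (T v₀₁ → T (v₁₁ ∧ (v₁₀ ∧ v₀₀))) →
  ρᵇ v₁₁ v₀₀ (not v₀₁) ℤ.≤ D * + 2 + (bit e - bit f)
  ⇔ ((bit (select v₁₁ v₁₀ v₀₁ v₀₀ e f) ℤ.≤ D + (bit e - bit f))
     × (bit (select v₁₁ v₁₀ v₀₁ v₀₀ (not e) (not f)) ℤ.≤ D))

pairTable? : (D : ℤ) → Dec (PairTable D)
pairTable? D =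
  ∀-Bool? λ e → ∀-Bool? λ f → ∀-Bool? λ v₁₁ → ∀-Bool? λ v₁₀ → ∀-Bool? λ v₀₁ → ∀-Bool? λ v₀₀ →
  (T? v₀₁ →-dec T? (v₁₁ ∧ (v₁₀ ∧ v₀₀))) →-dec
  ((ρᵇ v₁₁ v₀₀ (not v₀₁) ≤ℤ? D * + 2 + (bit e - bit f))
   ⇔-dec ((bit (select v₁₁ v₁₀ v₀₁ v₀₀ e f) ≤ℤ? D + (bit e - bit f))
          ×-dec (bit (select v₁₁ v₁₀ v₀₁ v₀₀ (not e) (not f)) ≤ℤ? D)))

-- For D ≥ 2 both sides hold and for D ≤ -1 both fail, so these cases are decided with D symbolic.
pairTable : (D : ℤ) → PairTable D
pairTable (+ 0)           = from-yes (pairTable? (+ 0))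
pairTable (+ 1)           = from-yes (pairTable? (+ 1))
pairTable (+ suc (suc k)) = from-yes (pairTable? (+ suc (suc k)))
pairTable -[1+ 0 ]        = from-yes (pairTable? -[1+ 0 ])
pairTable -[1+ suc k ]    = from-yes (pairTable? -[1+ suc k ])

pairTable-tabulated : (g : Bool → Bool → Bool) →
  (T (g false true) → T (g true true ∧ (g true false ∧ g false false))) → (D : ℤ) (e f : Bool) →
  ρᵇ (g true true) (g false false) (not (g false true)) ℤ.≤ D * + 2 + (bit e - bit f)
  ⇔ ((bit (g e f) ℤ.≤ D + (bit e - bit f)) × (bit (g (not e) (not f)) ℤ.≤ D))
pairTable-tabulated g ordered D e f rewrite select-table g e f | select-table g (not e) (not f) =
  pairTable D e f _ _ _ _ ordered

module _ {n : ℕ} (x' y' x y : Col n) where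

  [≤] : Bool → Bool → Bool
  [≤] s t = does ((if s then x' else y') ≤? (if t then x else y))

  ρS-tabulated : ρS {n} x' y' x y ≡ ρᵇ ([≤] true true) ([≤] false false) (not ([≤] false true))
  ρS-tabulated =
    cong₂ _-_ (cong₂ _+_ (χ-bit (x' ≤? x)) (χ-bit (y' ≤? y)))
              (trans (χ-bit ((y' ≤? y) ×-dec ((x <? y') ×-dec (x' ≤? x))))
                     (cong (λ c → bit ([≤] false false ∧ (c ∧ [≤] true true)))
                           (does-complement ℕₚ.<⇒≱ ℕₚ.≰⇒> (x <? y') (y' ≤? x))))

  [≤]-ordered : x' Fin.≤ y' → x Fin.≤ y →
                T ([≤] false true) → T ([≤] true true ∧ ([≤] true false ∧ [≤] false false))
  [≤]-ordered x'≤y' x≤y [y'≤x] =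
    Equivalence.from T-∧ (ℕₚ.≤⇒≤ᵇ (ℕₚ.≤-trans x'≤y' y'≤x) ,
    Equivalence.from T-∧ (ℕₚ.≤⇒≤ᵇ (ℕₚ.≤-trans x'≤y' y'≤y) , ℕₚ.≤⇒≤ᵇ y'≤y))
    where
    y'≤x = ℕₚ.≤ᵇ⇒≤ (toℕ y') (toℕ x) [y'≤x]
    y'≤y = ℕₚ.≤-trans y'≤x x≤y

  private
    size-difference : ∀ b c k l → (b + k * + 2) - (c + l * + 2) ≡ (k - l) * + 2 + (b - c)
    size-difference = solve-∀
    η-difference : ∀ b c k l → (k + b) - (l + c) ≡ (k - l) + (b - c)
    η-difference = solve-∀

  ρS⇔η-ζ-half : x' Fin.≤ y' → x Fin.≤ y → (e f : Bool) (k l : ℤ) →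
    ρS {n} x' y' x y ℤ.≤ (bit e + k * + 2) - (bit f + l * + 2)
    ⇔ ((χ ((if e then x' else y') ≤? (if f then x else y)) ℤ.≤ (k + bit e) - (l + bit f))
       × (χ ((if not e then x' else y') ≤? (if not f then x else y)) ℤ.≤ k - l))
  ρS⇔η-ζ-half x'≤y' x≤y e f k l
    rewrite ρS-tabulated
          | χ-bit ((if e then x' else y') ≤? (if f then x else y))
          | χ-bit ((if not e then x' else y') ≤? (if not f then x else y))
          | size-difference (bit e) (bit f) k l
          | η-difference (bit e) (bit f) k l
    = pairTable-tabulated [≤] ([≤]-ordered x'≤y' x≤y) (k - l) e f

module _ {n : ℕ} where

  ρS⇔η-ζ : (p q : SInt n) → ValidS p → ValidS q →
    ρS {n} (cx p) (cy p) (cx q) (cy q) ℤ.≤ sval p - sval q ⇔ ((η p >ₚ η q) × (ζ p >ₚ ζ q))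
  ρS⇔η-ζ p@(A ⟪ x' , y' ⟫) q@(B ⟪ x , y ⟫) x'≤y' x≤y with half-decomposition A | half-decomposition B
  ... | e , k , refl | f , l , refl =
    let ηp≡ , ζp≡ = η-ζ-half e k x' y'
        ηq≡ , ζq≡ = η-ζ-half f l x y
    in  transport ηp≡ ζp≡ ηq≡ ζq≡ (ρS⇔η-ζ-half {n} x' y' x y x'≤y' x≤y e f k l)
    where
    transport : ∀ {P a b c d} → η p ≡ a → ζ p ≡ b → η q ≡ c → ζ q ≡ d →
                P ⇔ ((a >ₚ c) × (b >ₚ d)) → P ⇔ ((η p >ₚ η q) × (ζ p >ₚ ζ q))
    transport refl refl refl refl P⇔ = P⇔

-- The colours \overline{j}

m∸n≡1+m∸[1+n] : ∀ {m n} → n ℕ.< m → m ∸ n ≡ suc (m ∸ suc n)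
m∸n≡1+m∸[1+n] {suc m} {zero}  _         = refl
m∸n≡1+m∸[1+n] {suc m} {suc n} (s≤s n<m) = m∸n≡1+m∸[1+n] n<m

module _ {n : ℕ} where

  toℕ-unbarred : (j : Fin n) → toℕ (unbarred n j) ≡ toℕ j
  toℕ-unbarred j = toℕ-↑ˡ j n

  toℕ-barred : (j : Fin n) → toℕ (barred n j) ≡ (n ℕ.+ n) ∸ suc (toℕ j)
  toℕ-barred j = trans (opposite-prop (j ↑ˡ n)) (cong (λ t → (n ℕ.+ n) ∸ suc t) (toℕ-unbarred j))

  unbarred<barred : (j j' : Fin n) → unbarred n j Fin.< barred n j'
  unbarred<barred j j' = ℕₚ.<-≤-trans (subst (ℕ._< n) (sym (toℕ-unbarred j)) (toℕ<n j))
    (subst (n ℕ.≤_) (sym (toℕ-barred j')) (ℕₚ.m+n≤o⇒m≤o∸n n (ℕₚ.+-monoʳ-≤ n (toℕ<n j'))))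

  barred≡1+barNext : (j : Fin n) → toℕ (barred n j) ≡ suc (toℕ (barNext n j))
  barred≡1+barNext j with suc (toℕ j) ℕ.<? n
  ... | yes j+1<n = begin
    toℕ (barred n j)                           ≡⟨ toℕ-barred j ⟩
    (n ℕ.+ n) ∸ suc (toℕ j)                    ≡⟨ m∸n≡1+m∸[1+n] (ℕₚ.≤-trans j+1<n (ℕₚ.m≤m+n n n)) ⟩
    suc ((n ℕ.+ n) ∸ suc (suc (toℕ j)))        ≡⟨ cong (λ t → suc ((n ℕ.+ n) ∸ suc t)) (sym (toℕ-fromℕ< j+1<n)) ⟩
    suc ((n ℕ.+ n) ∸ suc (toℕ (fromℕ< j+1<n))) ≡⟨ cong suc (sym (toℕ-barred (fromℕ< j+1<n))) ⟩
    suc (toℕ (barred n (fromℕ< j+1<n)))        ∎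
    where open ≡-Reasoning
  ... | no j+1≮n = begin
    toℕ (barred n j)         ≡⟨ toℕ-barred j ⟩
    (n ℕ.+ n) ∸ suc (toℕ j)  ≡⟨ cong ((n ℕ.+ n) ∸_) j+1≡n ⟩
    (n ℕ.+ n) ∸ n            ≡⟨ ℕₚ.m+n∸n≡m n n ⟩
    n                        ≡⟨ sym j+1≡n ⟩
    suc (toℕ j)              ≡⟨ cong suc (sym (toℕ-unbarred j)) ⟩
    suc (toℕ (unbarred n j)) ∎
    where
    open ≡-Reasoning
    j+1≡n : suc (toℕ j) ≡ n
    j+1≡n = ℕₚ.≤-antisym (toℕ<n j) (ℕₚ.≮⇒≥ j+1≮n)

  unbarred≤barNext : (j : Fin n) → unbarred n j Fin.≤ barNext n j
  unbarred≤barNext j =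
    ℕ.s≤s⁻¹ (subst (suc (toℕ (unbarred n j)) ℕ.≤_) (barred≡1+barNext j) (unbarred<barred j j))

  ≤-predecessor : {b c y : Col n} → toℕ b ≡ suc (toℕ c) → y ≢ b → (y Fin.≤ b ⇔ y Fin.≤ c)
  ≤-predecessor b≡1+c y≢b = mk⇔
    (λ y≤b → ℕ.s≤s⁻¹ (subst (ℕ._≤_ _) b≡1+c (≤∧≢⇒< y≤b y≢b)))
    (λ y≤c → subst (ℕ._≤_ _) (sym b≡1+c) (ℕₚ.m≤n⇒m≤1+n y≤c))

≤-1̄ : {m : ℕ} (x : Col (suc m)) → x Fin.≤ barred (suc m) zero
≤-1̄ x = subst (toℕ x ℕ.≤_) (sym (toℕ-barred zero)) (toℕ≤pred[n] x)

-- The last part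

-- ρ and both branches of the energy H have this shape.
ρ-shape : {A B C : Set} → Dec A → Dec B → Dec C → ℤ
ρ-shape a b c = (χ a + χ b) - χ (b ×-dec (c ×-dec a))

ρ-shape-cong : {A A' B B' C : Set} → A ⇔ A' → B ⇔ B' →
               (a : Dec A) (b : Dec B) (c : Dec C) (a' : Dec A') (b' : Dec B') → ρ-shape a b c ≡ ρ-shape a' b' c
ρ-shape-cong A⇔A' B⇔B' a b c a' b' =
  cong₂ _-_ (cong₂ _+_ (χ-cong A⇔A' a a') (χ-cong B⇔B' b b'))
            (χ-cong (B⇔B' ×-⇔ (⇔.refl ×-⇔ A⇔A')) (b ×-dec (c ×-dec a)) (b' ×-dec (c ×-dec a')))

1≤a-0⇔2≤a+1 : (a : ℤ) → + 1 ℤ.≤ a - + 0 ⇔ + 2 ℤ.≤ a - -[1+ 0 ]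
1≤a-0⇔2≤a+1 (+ 0)         = mk⇔ (λ { (+≤+ ()) }) (λ { (+≤+ (s≤s ())) })
1≤a-0⇔2≤a+1 (+ suc k)     = mk⇔ (λ _ → +≤+ (s≤s (ℕₚ.m≤n+m 1 k))) (λ _ → +≤+ (s≤s z≤n))
1≤a-0⇔2≤a+1 -[1+ 0 ]      = mk⇔ (λ ()) (λ { (+≤+ ()) })
1≤a-0⇔2≤a+1 -[1+ suc _ ]  = mk⇔ (λ ()) (λ ())

module _ (m : ℕ) where

  private
    n = suc m

  ρS-1̄ : (x y : Col n) → ρS {n} x y (barred n zero) (barred n zero) ≡ + 2
  ρS-1̄ x y = cong₂ _-_ (cong₂ _+_ (χ-yes (≤-1̄ x) (x ≤? 1̄)) (χ-yes (≤-1̄ y) (y ≤? 1̄)))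
                       (χ-no (λ (_ , 1̄<y , _) → ℕₚ.<⇒≱ 1̄<y (≤-1̄ y))
                             ((y ≤? 1̄) ×-dec ((1̄ <? y) ×-dec (x ≤? 1̄))))
    where 1̄ = barred n zero

  module _ (j : Fin n) where

    private
      uj = unbarred n j
      bj = barred n j
      bN = barNext n j

      bj≰bN : ¬ (bj Fin.≤ bN)
      bj≰bN bj≤bN = ℕₚ.<-irrefl refl (subst (ℕ._≤ toℕ bN) (barred≡1+barNext j) bj≤bN)

      off-bar : {x y : Col n} → y ≢ bj → H {n} (pair uj bj) (pair x y) ≡ ρS {n} x y uj bN
      off-bar {x} {y} y≢bj with opposite y ≟ uj
      ... | yes ȳ≡uj = ⊥-elim (y≢bj (trans (sym (opposite-involutive y)) (cong opposite ȳ≡uj)))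
      ... | no _     = ρ-shape-cong ⇔.refl (≤-predecessor {n} (barred≡1+barNext j) y≢bj)
                                    (x ≤? uj) (y ≤? bj) (uj <? y) (x ≤? uj) (y ≤? bN)

      on-bar : {x : Col n} → x ≢ uj → H {n} (pair uj bj) (pair x bj) ≡ ρS {n} x bj uj bN
      on-bar {x} x≢uj with opposite bj ≟ uj
      ... | yes _      = ρ-shape-cong (mk⇔ ℕₚ.<⇒≤ (λ x≤uj → ≤∧≢⇒< x≤uj x≢uj))
                                      (mk⇔ (⊥-elim ∘ ℕₚ.n≮n _) (⊥-elim ∘ bj≰bN))
                                      (x <? uj) (bj <? bj) (uj <? bj) (x ≤? uj) (bj ≤? bN)
      ... | no b̄j≢uj = ⊥-elim (b̄j≢uj (opposite-involutive uj))

    ρ∞-suc : (x y : Col n) → ρ∞ m (suc j) x y ≡ ρS {n} x y uj bN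
    ρ∞-suc x y with x ≟ uj | y ≟ bj
    ... | yes refl | yes refl =
      sym (cong₂ _-_ (cong₂ _+_ (χ-yes ℕₚ.≤-refl (uj ≤? uj)) (χ-no bj≰bN (bj ≤? bN)))
                     (χ-no (bj≰bN ∘ proj₁) ((bj ≤? bN) ×-dec ((uj <? bj) ×-dec (uj ≤? uj)))))
    ... | yes _    | no y≢bj  = off-bar y≢bj
    ... | no _     | no y≢bj  = off-bar y≢bj
    ... | no x≢uj  | yes refl = on-bar x≢uj

  ρ∞⇔ρS-ω : (i : Fin (suc n)) (a : ℤ) (x y : Col n) →
            ρ∞ m i x y ℤ.≤ a - + 0 ⇔ ρS {n} x y (cx (ω m i)) (cy (ω m i)) ℤ.≤ a - sval (ω m i)
  ρ∞⇔ρS-ω zero    a x y rewrite ρS-1̄ x y   = 1≤a-0⇔2≤a+1 a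
  ρ∞⇔ρS-ω (suc j) a x y rewrite ρ∞-suc j x y = ⇔.refl

  ω-valid : (i : Fin (suc n)) → ValidS (ω m i)
  ω-valid zero    = ℕₚ.≤-refl
  ω-valid (suc j) = unbarred≤barNext j

  η-ω : (i : Fin (suc n)) → η (ω m i) ≡ tgtK m i
  η-ω zero    = refl
  η-ω (suc j) = refl

  ζ-ω : (i : Fin (suc n)) → ζ (ω m i) ≡ tgtL m i
  ζ-ω zero    = refl
  ζ-ω (suc j) = refl

  chain⇔decreasing : (i : Fin (suc n)) (ps : List (SInt n)) → AllL ValidS ps →
                     ChainP m i ps ⇔ (Decr (Φμ m i ps) × Decr (Φν m i ps))
  chain⇔decreasing i []       []        = mk⇔ (λ _ → tt , tt) (λ _ → tt)
  chain⇔decreasing i (p ∷ []) (vp ∷ []) = mk⇔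
    (λ c → let ηp>ηω , ζp>ζω = Equivalence.to last (Equivalence.to absorb c)
           in  (ηp>ηω , tt) , (ζp>ζω , tt))
    (λ ((ηp>ηω , _) , (ζp>ζω , _)) → Equivalence.from absorb (Equivalence.from last (ηp>ηω , ζp>ζω)))
    where
    absorb = ρ∞⇔ρS-ω i (sval p) (cx p) (cy p)
    last   = ρS⇔η-ζ p (ω m i) vp (ω-valid i)
  chain⇔decreasing i (p ∷ qs@(q ∷ _)) (vp ∷ vqs@(vq ∷ _)) =
    zip-⇔ (ρS⇔η-ζ p q vp vq) (chain⇔decreasing i qs vqs)

-- Lists of parts

dropLast-∷ʳ : {A : Set} (xs : List A) (a : A) → dropLast (xs ∷ʳ a) ≡ xs
dropLast-∷ʳ []           _ = refl
dropLast-∷ʳ (x ∷ [])     _ = refl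
dropLast-∷ʳ (x ∷ y ∷ xs) a = cong (x ∷_) (dropLast-∷ʳ (y ∷ xs) a)

module _ {A B C : Set} {f : A → B} {g : A → C} where

  map₂-injective : (∀ {a a'} → f a ≡ f a' → g a ≡ g a' → a ≡ a') →
                   (xs ys : List A) → map f xs ≡ map f ys → map g xs ≡ map g ys → xs ≡ ys
  map₂-injective inj []       []       _   _   = refl
  map₂-injective inj (x ∷ xs) (y ∷ ys) fxs gxs with ∷-injective fxs | ∷-injective gxs
  ... | fx≡fy , fxs≡fys | gx≡gy , gxs≡gys =
    cong₂ _∷_ (inj fx≡fy gx≡gy) (map₂-injective inj xs ys fxs≡fys gxs≡gys)

  map₂-pointwise : {P : A → Set} {R : B → C → Set} → (∀ {a} → P a → R (f a) (g a)) →
                   {xs : List A} → AllL P xs → Pointwise R (map f xs) (map g xs)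
  map₂-pointwise P⇒R []         = []
  map₂-pointwise P⇒R (px ∷ pxs) = P⇒R px ∷ map₂-pointwise P⇒R pxs

  map₂-surjective : {P : A → Set} {R : B → C → Set} →
                    (∀ b c → R b c → Σ A λ a → P a × f a ≡ b × g a ≡ c) →
                    (bs : List B) (cs : List C) → Pointwise R bs cs →
                    Σ (List A) λ xs → AllL P xs × map f xs ≡ bs × map g xs ≡ cs
  map₂-surjective sect []       []       []       = [] , [] , refl , refl
  map₂-surjective sect (b ∷ bs) (c ∷ cs) (r ∷ rs) with sect b c r | map₂-surjective sect bs cs rs
  ... | x , px , fx≡b , gx≡c | xs , pxs , fxs≡bs , gxs≡cs =
    x ∷ xs , px ∷ pxs , cong₂ _∷_ fx≡b fxs≡bs , cong₂ _∷_ gx≡c gxs≡cs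

module _ {n : ℕ} where

  η-ζ-size-sum : (ps : List (SInt n)) → sumℤ (map val (map η ps)) + sumℤ (map val (map ζ ps)) ≡ sizeP ps
  η-ζ-size-sum []       = refl
  η-ζ-size-sum (p ∷ ps) =
    trans (interchange (val (η p)) (val (ζ p)) _ _) (cong₂ _+_ (η-ζ-size p) (η-ζ-size-sum ps))
    where
    interchange : ∀ a b s t → (a + s) + (b + t) ≡ (a + b) + (s + t)
    interchange = solve-∀

  η-ζ-colours : (ps : List (SInt n)) → AllL ValidS ps →
                zipWith (prodCol {n}) (map col (map η ps)) (map col (map ζ ps)) ≡ colsP ps
  η-ζ-colours []       []         = refl
  η-ζ-colours (p ∷ ps) (vp ∷ vps) = cong₂ _∷_ (η-ζ-colour p vp) (η-ζ-colours ps vps)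

module _ (m : ℕ) (i : Fin (suc (suc m))) where

  Φ-into : (ps : List (SInt (suc m))) → InP m i ps → InF (tgtK m i) (tgtL m i) (Φμ m i ps) (Φν m i ps)
  Φ-into ps (vps , chain) =
    map η ps , map ζ ps , cong (map η ps ∷ʳ_) (η-ω m i) , cong (map ζ ps ∷ʳ_) (ζ-ω m i) ,
    map₂-pointwise (λ {s} → η-ζ-interlaced s) vps , Equivalence.to (chain⇔decreasing m i ps vps) chain

  Φ-injective : (ps qs : List (SInt (suc m))) →
                Φμ m i ps ≡ Φμ m i qs → Φν m i ps ≡ Φν m i qs → ps ≡ qs
  Φ-injective ps qs μ≡ ν≡ = map₂-injective (λ {p} {q} → η-ζ-injective p q) ps qs
    (∷ʳ-injectiveˡ (map η ps) (map η qs) μ≡) (∷ʳ-injectiveˡ (map ζ ps) (map ζ qs) ν≡)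

  Φ-onto : (μ ν : List (PInt (suc m))) → InF (tgtK m i) (tgtL m i) μ ν →
           Σ (List (SInt (suc m))) λ ps → InP m i ps × (Φμ m i ps ≡ μ) × (Φν m i ps ≡ ν)
  Φ-onto μ ν (μ′ , ν′ , μ≡ , ν≡ , interlaced , decreasing)
    with map₂-surjective η-ζ-surjective μ′ ν′ interlaced
  ... | ps , vps , ηps≡ , ζps≡ = ps , (vps , chain) , Φμ≡ , Φν≡
    where
    Φμ≡ : Φμ m i ps ≡ μ
    Φμ≡ = trans (cong₂ _∷ʳ_ ηps≡ (η-ω m i)) (sym μ≡)
    Φν≡ : Φν m i ps ≡ ν
    Φν≡ = trans (cong₂ _∷ʳ_ ζps≡ (ζ-ω m i)) (sym ν≡)
    chain : ChainP m i ps
    chain = Equivalence.from (chain⇔decreasing m i ps vps)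
                             (subst₂ (λ a b → Decr a × Decr b) (sym Φμ≡) (sym Φν≡) decreasing)

  Φ-preserves : (ps : List (SInt (suc m))) → AllL ValidS ps →
                (sizeF (Φμ m i ps) (Φν m i ps) ≡ sizeP ps) × (colsF (Φμ m i ps) (Φν m i ps) ≡ colsP ps)
  Φ-preserves ps vps rewrite dropLast-∷ʳ (map η ps) (η (ω m i)) | dropLast-∷ʳ (map ζ ps) (ζ (ω m i)) =
    η-ζ-size-sum ps , η-ζ-colours ps vps

theorem4p3 : (m : ℕ) (i : Fin (suc (suc m))) →
    ((ps : List (SInt (suc m))) → InP m i ps →
      InF (tgtK m i) (tgtL m i) (Φμ m i ps) (Φν m i ps))
  × ((ps qs : List (SInt (suc m))) → InP m i ps → InP m i qs →
      Φμ m i ps ≡ Φμ m i qs → Φν m i ps ≡ Φν m i qs → ps ≡ qs)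
  × ((μ ν : List (PInt (suc m))) → InF (tgtK m i) (tgtL m i) μ ν →
      Σ (List (SInt (suc m))) λ ps → InP m i ps × (Φμ m i ps ≡ μ) × (Φν m i ps ≡ ν))
  × ((ps : List (SInt (suc m))) → InP m i ps →
      (sizeF (Φμ m i ps) (Φν m i ps) ≡ sizeP ps)
      × (colsF (Φμ m i ps) (Φν m i ps) ≡ colsP ps))
theorem4p3 m i =
    Φ-into m i
  , (λ ps qs _ _ → Φ-injective m i ps qs)
  , Φ-onto m i
  , (λ ps (vps , _) → Φ-preserves m i ps vps)
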